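{- Let $P,N\subseteq\mathcal{D}$ be disjoint sets of variables, not both empty, with $P=\{x_{i}: i\in I_P\}$, $N=\{x_j : j\in I_N\}$, and let $\phi=\bigvee_{x\in P}x\ \lor\ \bigvee_{x\in N}\neg x$ be the corresponding disjunctive clause. Its algebraic normal form is the Boolean polynomial $p=1+\prod_{x\in P}(1+x)\prod_{x\in N}x$. Define the power term polynomial $\pi$ by: (1) if $N=\emptyset$: $\pi=S_\emptyset.\mathbf{P}_{P}$ when $|P|>1$, and $\pi=S_{P}.\mathbf{P}_\emptyset$ when $|P|=1$; (2) if $P=\emptyset$: $\pi=S_I.\mathbf{P}_\emptyset\uplus S_{N}.\mathbf{P}_\emptyset$; (3) if $P\neq\emptyset$ and $N\neq\emptyset$: $\pi=S_I.\mathbf{P}_\emptyset\uplus S_{N}.\mathbf{P}_\emptyset\uplus S_{N}.\mathbf{P}_{P}$ when $|P|>1$, and $\pi=S_I.\mathbf{P}_\emptyset\uplus S_{N}.\mathbf{P}_\emptyset\uplus S_{N\cup P}.\mathbf{P}_\emptyset$ when $|P|=1$. Then $\pi$ is a minimal power term polynomial representing $p$ (i.e. $[\![\pi]\!]=p$), and $\mathrm{Size}(\pi)\le 3$ (namely $1$, $2$, $3$ in cases (1), (2), (3) respectively), independently of the number of positive literals.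
   Context: Let $\mathcal{D}=\{x_1,\dots,x_n\}$ be a set of Boolean variables. Boolean polynomials are elements of $\mathbb{F}_2[x_1,\dots,x_n]/(x_i^2-x_i : i\in[n])$; the ANF of a clause is obtained via $\mathrm{ANF}(C)=1+\mathrm{ANF}(\neg C)$, where a positive literal $x$ negates to $1+x$ and a negative literal $\neg x$ negates to $x$, and the conjunction is a product. For $W\subseteq\mathcal{D}$ write $m_W=\prod_{x\in W}x$ ($m_\emptyset=1$); $S_W$ denotes the set $W$ used as a base. For $U\subseteq\mathcal{D}$ the modified power set is $\mathbf{P}_U=\{\emptyset\}$ if $U=\emptyset$ and $\mathbf{P}_U=\{T\subseteq U: T\neq\emptyset\}$ otherwise. A (well-formed) power term $S.\mathbf{P}_U$ has $S,U\subseteq\mathcal{D}$ with $S\cap U=\emptyset$, $|U|\neq 1$, $(S,U)\neq(\emptyset,\emptyset)$, and semantics $[\![S.\mathbf{P}_U]\!]=\sum_{T\in\mathbf{P}_U} m_{S\cup T}$. The constants $S_\emptyset.\mathbf{P}_\emptyset$ and $S_I.\mathbf{P}_\emptyset$ have semantics $0$ and $1$. A power term polynomial is a formal expression built from power terms and constants by a commutative, associative operator $\uplus$ with identity $S_\emptyset.\mathbf{P}_\emptyset$ and $\pi\uplus\pi=S_\emptyset.\mathbf{P}_\emptyset$; its semantics is $[\![\pi\uplus\rho]\!]=[\![\pi]\!]+[\![\rho]\!]$ over $\mathbb{F}_2$. $\mathrm{Size}(\pi)$ is the number of atomic terms (power terms or constants) occurring in $\pi$; $\pi$ is minimal for $p$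 if $[\![\pi]\!]=p$ and $\mathrm{Size}(\pi)\le\mathrm{Size}(\rho)$ for every $\rho$ with $[\![\rho]\!]=p$. -}

module Defs where

open import Data.Nat using (ℕ; zero; suc)
open import Data.Bool using (Bool; true; false; _∧_; _xor_; not; if_then_else_)
import Data.Bool as B
open import Data.Fin using (Fin)
open import Data.Fin.Subset using (Subset; ⊥; _∪_; _∩_; ∣_∣; ⁅_⁆; outside; inside)
open import Data.Fin.Subset.Properties using (_⊆?_; nonempty?)
open import Data.Vec using (Vec; []; _∷_; lookup; allFin)
open import Data.Vec.Properties using (≡-dec)
open import Data.List using (List; []; _∷_; _++_; map; filter; foldr; concatMap; length)
open import Data.List.Relation.Unary.All using (All)
open import Data.Product using (_×_)
open import Data.Unit using (⊤)
open import Relation.Nullary using (¬_; Dec; yes; no)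
open import Relation.Nullary.Decidable using (⌊_⌋)
open import Relation.Binary.PropositionalEquality using (_≡_; _≢_)

-- Variables are x_0 … x_{n-1}, i.e. Fin n; sets of variables are Subset n.

_≟ₛ_ : {n : ℕ} (A B : Subset n) → Dec (A ≡ B)
_≟ₛ_ = ≡-dec B._≟_

allSubsets : (n : ℕ) → List (Subset n)
allSubsets zero    = [] ∷ []
allSubsets (suc n) = map (outside ∷_) (allSubsets n) ++ map (inside ∷_) (allSubsets n)

-- Boolean polynomials: F₂[x_1..x_n]/(x_i² - x_i) has the multilinear
-- monomials m_W (W ⊆ D) as an F₂-basis, so a Boolean polynomial is given
-- by its coefficient function W ↦ coefficient of m_W.

BPoly : ℕ → Set
BPoly n = Subset n → Bool

_≈_ : {n : ℕ} → BPoly n → BPoly n → Set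
p ≈ q = ∀ W → p W ≡ q W

xorSum : List Bool → Bool
xorSum = foldr _xor_ false

𝟘 : {n : ℕ} → BPoly n
𝟘 _ = false

mon : {n : ℕ} → Subset n → BPoly n
mon W V = ⌊ V ≟ₛ W ⌋

𝟙 : {n : ℕ} → BPoly n
𝟙 = mon ⊥

var : {n : ℕ} → Fin n → BPoly n
var i = mon ⁅ i ⁆

_+ₚ_ : {n : ℕ} → BPoly n → BPoly n → BPoly n
(p +ₚ q) W = p W xor q W

-- multiplication, using m_A · m_B = m_{A ∪ B}  (since x² = x)
_*ₚ_ : {n : ℕ} → BPoly n → BPoly n → BPoly n
_*ₚ_ {n} p q W =
  xorSum (concatMap (λ A → map (λ C → p A ∧ q C)
                                (filter (λ C → (A ∪ C) ≟ₛ W) (allSubsets n)))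
                    (allSubsets n))

sumₚ : {n : ℕ} → List (BPoly n) → BPoly n
sumₚ = foldr _+ₚ_ 𝟘

prodOver : {n : ℕ} → Subset n → (Fin n → BPoly n) → BPoly n
prodOver {n} X f = Data.Vec.foldr (λ _ → BPoly n)
  (λ i acc → if lookup X i then f i *ₚ acc else acc) 𝟙 (allFin n)

clauseANF : {n : ℕ} → Subset n → Subset n → BPoly n
clauseANF P N = 𝟙 +ₚ (prodOver P (λ i → 𝟙 +ₚ var i) *ₚ prodOver N var)

powerSetP : {n : ℕ} → Subset n → List (Subset n)
powerSetP {n} U with ∣ U ∣
... | zero  = ⊥ ∷ []
... | suc _ = filter (λ T → T ⊆? U) (filter nonempty? (allSubsets n))

-- atomic terms: the constants S_∅.𝐏_∅ (zero) and S_I.𝐏_∅ (one), and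
-- power terms S.𝐏_U
data Atom (n : ℕ) : Set where
  constZero : Atom n
  constOne  : Atom n
  pt        : Subset n → Subset n → Atom n

WellFormed : {n : ℕ} → Atom n → Set
WellFormed constZero = ⊤
WellFormed constOne  = ⊤
WellFormed (pt S U)  = (S ∩ U ≡ ⊥) × (∣ U ∣ ≢ 1) × ¬ ((S ≡ ⊥) × (U ≡ ⊥))

⟦_⟧ₐ : {n : ℕ} → Atom n → BPoly n
⟦ constZero ⟧ₐ = 𝟘
⟦ constOne  ⟧ₐ = 𝟙
⟦ pt S U    ⟧ₐ = sumₚ (map (λ T → mon (S ∪ T)) (powerSetP U))

-- Power term polynomials: a formal ⊎-combination of atomic terms.  Since
-- ⊎ is associative and commutative, such an expression is a list of its
-- atomic term occurrences; Size is the number of atomic terms occurring.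
PTPoly : ℕ → Set
PTPoly n = List (Atom n)

WellFormedPTP : {n : ℕ} → PTPoly n → Set
WellFormedPTP = All WellFormed

⟦_⟧ : {n : ℕ} → PTPoly n → BPoly n
⟦ π ⟧ = sumₚ (map ⟦_⟧ₐ π)

Size : {n : ℕ} → PTPoly n → ℕ
Size = length

Minimal : {n : ℕ} → PTPoly n → BPoly n → Set
Minimal {n} π p = (⟦ π ⟧ ≈ p) ×
  (∀ (ρ : PTPoly n) → WellFormedPTP ρ → ⟦ ρ ⟧ ≈ p → Size π Data.Nat.≤ Size ρ)

clausePTP : {n : ℕ} → Subset n → Subset n → PTPoly n
clausePTP P N with ∣ P ∣ | ∣ N ∣
... | zero        | zero  = []   -- excluded: P, N not both empty
... | suc zero    | zero  = pt P ⊥ ∷ []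
... | suc (suc _) | zero  = pt ⊥ P ∷ []
... | zero        | suc _ = constOne ∷ pt N ⊥ ∷ []
... | suc zero    | suc _ = constOne ∷ pt N ⊥ ∷ pt (N ∪ P) ⊥ ∷ []
... | suc (suc _) | suc _ = constOne ∷ pt N ⊥ ∷ pt N P ∷ []

-- Evaluating a Boolean polynomial at an assignment x, i.e. adding up the coefficients of
-- the monomials m_W with W ⊆ x, is multiplicative, and by Möbius inversion a polynomial
-- is determined by its truth table; so identities between polynomials can be checked
-- pointwise.  The ANF of φ evaluates to φ, and for U ≠ ∅ the power term S.𝐏_U evaluates
-- to [S ⊆ x] ∧ [U ∩ x ≠ ∅]; this gives ⟦π⟧ = p case by case.
--
-- For minimality, every well-formed atom is either constant or false at the empty and
-- true at the full assignment.  Hence one atom true at ∅ is true everywhere, and a sum of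
-- two atoms true at ∅ and at ⊤ is true everywhere.  The clause is true at ∅ iff N ≠ ∅,
-- true at ⊤ iff P ≠ ∅, and false at N; this forces at least 1, 2, 3 atoms in the three cases.

module Submission where

open import Defs
open import Data.Nat using (ℕ; zero; suc; _≤_; z≤n; s≤s)
open import Data.Nat.Properties using (suc-injective)
open import Data.Bool using (Bool; true; false; _∧_; _xor_; not; if_then_else_)
open import Data.Bool.Properties
  using ( xor-∧-commutativeRing; xor-identityʳ; xor-assoc; xor-comm; xor-same; not-¬
        ; ∧-assoc; ∧-comm; ∧-zeroʳ; ∧-identityʳ; ∧-distribʳ-xor)
open import Algebra.Bundles using (CommutativeRing)
open import Algebra.Properties.CommutativeSemigroup
  (CommutativeRing.+-commutativeSemigroup xor-∧-commutativeRing) using (interchange)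
open import Algebra.Properties.CommutativeSemigroup
  (CommutativeRing.*-commutativeSemigroup xor-∧-commutativeRing)
  using () renaming (interchange to ∧-interchange)
open import Data.Vec using (Vec; _∷_; []; lookup; tabulate; allFin)
import Data.Vec as V
open import Data.Fin using (Fin; zero; suc)
open import Function using (_∘_; id)
open import Data.Fin.Subset using (Subset; ⊥; ⊤; _⊆_; _∪_; _∩_; ⁅_⁆; ∣_∣; outside; inside)
open import Data.Fin.Subset.Properties
  using ( _⊆?_; nonempty?; ∉⊥; Empty-unique; ∣⊥∣≡0; ⊥⊆; ⊆⊤; ⊆-refl; ⊆-antisym; p⊆p∪q
        ; ∪-identityʳ; ∩-zeroˡ; ∩-zeroʳ; ∩-identityʳ; ∩-comm)
open import Data.List using (List; []; _∷_; _++_; map; filter; concatMap)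
open import Data.List.Relation.Unary.All using ([]; _∷_)
open import Data.List.Properties using (map-++; map-∘; map-cong)
open import Relation.Nullary using (yes; no; ¬_; contradiction)
open import Data.Empty using (⊥-elim)
open import Data.Unit using (tt)
open import Data.Product using (_×_; _,_; proj₁; proj₂)
open import Relation.Nullary.Decidable using (does; isYes≗does; dec-true; dec-false)
open import Relation.Unary using (Pred; Decidable)
open import Relation.Binary.PropositionalEquality
open import Level using (0ℓ)

private variable n : ℕ

-- Stated with does rather than ⌊_⌋ so that both tests compute on _∷_ by pattern matching.
_≡ᵇ_ : Subset n → Subset n → Bool
V ≡ᵇ W = does (V ≟ₛ W)

_⊆ᵇ_ : Subset n → Subset n → Bool
V ⊆ᵇ W = does (V ⊆? W)

≡ᵇ-sym : (V W : Subset n) → V ≡ᵇ W ≡ W ≡ᵇ V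
≡ᵇ-sym []          []          = refl
≡ᵇ-sym (false ∷ V) (false ∷ W) = ≡ᵇ-sym V W
≡ᵇ-sym (false ∷ V) (true  ∷ W) = refl
≡ᵇ-sym (true  ∷ V) (false ∷ W) = refl
≡ᵇ-sym (true  ∷ V) (true  ∷ W) = ≡ᵇ-sym V W

⊥-⊆ᵇ : (x : Subset n) → ⊥ ⊆ᵇ x ≡ true
⊥-⊆ᵇ x = dec-true (⊥ ⊆? x) ⊥⊆

⁅⁆-⊆ᵇ : (i : Fin n) (x : Subset n) → ⁅ i ⁆ ⊆ᵇ x ≡ lookup x i
⁅⁆-⊆ᵇ zero    (false ∷ x) = refl
⁅⁆-⊆ᵇ zero    (true  ∷ x) = ⊥-⊆ᵇ x
⁅⁆-⊆ᵇ (suc i) (_     ∷ x) = ⁅⁆-⊆ᵇ i x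

∪-⊆ᵇ : (A C x : Subset n) → (A ∪ C) ⊆ᵇ x ≡ A ⊆ᵇ x ∧ C ⊆ᵇ x
∪-⊆ᵇ []          []          []          = refl
∪-⊆ᵇ (false ∷ A) (false ∷ C) (_     ∷ x) = ∪-⊆ᵇ A C x
∪-⊆ᵇ (false ∷ A) (true  ∷ C) (false ∷ x) = sym (∧-zeroʳ _)
∪-⊆ᵇ (false ∷ A) (true  ∷ C) (true  ∷ x) = ∪-⊆ᵇ A C x
∪-⊆ᵇ (true  ∷ A) (_     ∷ C) (false ∷ x) = refl
∪-⊆ᵇ (true  ∷ A) (false ∷ C) (true  ∷ x) = ∪-⊆ᵇ A C x
∪-⊆ᵇ (true  ∷ A) (true  ∷ C) (true  ∷ x) = ∪-⊆ᵇ A C x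

nonempty?-≡ᵇ : (T : Subset n) → does (nonempty? T) ≡ not (T ≡ᵇ ⊥)
nonempty?-≡ᵇ T with nonempty? T | T ≟ₛ ⊥
... | yes (_ , i∈T) | yes refl = ⊥-elim (∉⊥ i∈T)
... | yes _         | no _     = refl
... | no _          | yes _    = refl
... | no ¬ne        | no T≢⊥   = ⊥-elim (T≢⊥ (Empty-unique ¬ne))

∣∣≡0⇒≡⊥ : (U : Subset n) → ∣ U ∣ ≡ 0 → U ≡ ⊥
∣∣≡0⇒≡⊥ []          _     = refl
∣∣≡0⇒≡⊥ (false ∷ U) ∣U∣≡0 = cong (false ∷_) (∣∣≡0⇒≡⊥ U ∣U∣≡0)

∣∣≡suc⇒≢⊥ : (U : Subset n) {k : ℕ} → ∣ U ∣ ≡ suc k → U ≢ ⊥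
∣∣≡suc⇒≢⊥ {n} U ∣U∣≡1+k refl = contradiction (trans (sym (∣⊥∣≡0 n)) ∣U∣≡1+k) λ ()

⊆ᵇ-singleton : (P x : Subset n) → ∣ P ∣ ≡ 1 → P ⊆ᵇ x ≡ not ((P ∩ x) ≡ᵇ ⊥)
⊆ᵇ-singleton (false ∷ P) (_     ∷ x) ∣P∣≡1 = ⊆ᵇ-singleton P x ∣P∣≡1
⊆ᵇ-singleton (true ∷ P) (true  ∷ x) ∣P∣≡1 rewrite ∣∣≡0⇒≡⊥ P (suc-injective ∣P∣≡1) = ⊥-⊆ᵇ x
⊆ᵇ-singleton (true ∷ P) (false ∷ x) ∣P∣≡1 rewrite ∣∣≡0⇒≡⊥ P (suc-injective ∣P∣≡1) =
  cong not (sym (dec-true ((⊥ ∩ x) ≟ₛ ⊥) (∩-zeroˡ x)))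

⨁ : (Subset n → Bool) → Bool
⨁ {zero}  h = h []
⨁ {suc n} h = ⨁ (λ V → h (outside ∷ V)) xor ⨁ (λ V → h (inside ∷ V))

⨁-cong : {f g : Subset n → Bool} → (∀ V → f V ≡ g V) → ⨁ f ≡ ⨁ g
⨁-cong {zero}  f≗g = f≗g []
⨁-cong {suc n} f≗g = cong₂ _xor_ (⨁-cong (λ V → f≗g (outside ∷ V))) (⨁-cong (λ V → f≗g (inside ∷ V)))

⨁-false : ⨁ {n} (λ _ → false) ≡ false
⨁-false {zero}  = refl
⨁-false {suc n} = cong₂ _xor_ (⨁-false {n}) (⨁-false {n})

⨁-xor : (f g : Subset n → Bool) → ⨁ (λ V → f V xor g V) ≡ ⨁ f xor ⨁ g
⨁-xor {zero}  f g = refl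
⨁-xor {suc n} f g =
  trans (cong₂ _xor_ (⨁-xor (λ V → f (outside ∷ V)) (λ V → g (outside ∷ V)))
                     (⨁-xor (λ V → f (inside ∷ V)) (λ V → g (inside ∷ V))))
        (interchange (⨁ (λ V → f (outside ∷ V))) (⨁ (λ V → g (outside ∷ V)))
                     (⨁ (λ V → f (inside ∷ V))) (⨁ (λ V → g (inside ∷ V))))

⨁-∧ˡ : (c : Bool) (f : Subset n → Bool) → ⨁ (λ V → c ∧ f V) ≡ c ∧ ⨁ f
⨁-∧ˡ true  f = refl
⨁-∧ˡ {n} false f = ⨁-false {n}

⨁-∧ʳ : (f : Subset n → Bool) (c : Bool) → ⨁ (λ V → f V ∧ c) ≡ ⨁ f ∧ c
⨁-∧ʳ f true  = trans (⨁-cong (λ V → ∧-identityʳ (f V))) (sym (∧-identityʳ _))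
⨁-∧ʳ {n} f false = trans (⨁-cong (λ V → ∧-zeroʳ (f V))) (trans (⨁-false {n}) (sym (∧-zeroʳ _)))

⨁-comm : ∀ {m} (h : Subset m → Subset n → Bool) →
         ⨁ (λ A → ⨁ (λ C → h A C)) ≡ ⨁ (λ C → ⨁ (λ A → h A C))
⨁-comm {m = zero}  h = refl
⨁-comm {m = suc m} h =
  trans (cong₂ _xor_ (⨁-comm (λ A C → h (outside ∷ A) C)) (⨁-comm (λ A C → h (inside ∷ A) C)))
        (sym (⨁-xor (λ C → ⨁ (λ A → h (outside ∷ A) C)) (λ C → ⨁ (λ A → h (inside ∷ A) C))))

⨁-point : (W : Subset n) (h : Subset n → Bool) → ⨁ (λ V → V ≡ᵇ W ∧ h V) ≡ h W
⨁-point {zero}  []          h = refl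
⨁-point {suc n} (false ∷ W) h =
  trans (cong₂ _xor_ (⨁-point W (λ V → h (outside ∷ V))) (⨁-false {n})) (xor-identityʳ _)
⨁-point {suc n} (true  ∷ W) h =
  trans (cong (_xor ⨁ (λ V → V ≡ᵇ W ∧ h (inside ∷ V))) (⨁-false {n})) (⨁-point W (λ V → h (inside ∷ V)))

⨁-interval : (V W : Subset n) → ⨁ (λ x → V ⊆ᵇ x ∧ x ⊆ᵇ W) ≡ V ≡ᵇ W
⨁-interval []          []          = refl
⨁-interval (false ∷ V) (false ∷ W) =
  trans (cong₂ _xor_ (⨁-interval V W) (trans (⨁-∧ʳ (V ⊆ᵇ_) false) (∧-zeroʳ _))) (xor-identityʳ (V ≡ᵇ W))
⨁-interval (false ∷ V) (true  ∷ W) = xor-same (⨁ (λ x → V ⊆ᵇ x ∧ x ⊆ᵇ W))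
⨁-interval {suc n} (true  ∷ V) (false ∷ W) = cong₂ _xor_ (⨁-false {n}) (trans (⨁-∧ʳ (V ⊆ᵇ_) false) (∧-zeroʳ _))
⨁-interval {suc n} (true  ∷ V) (true  ∷ W) = cong₂ _xor_ (⨁-false {n}) (⨁-interval V W)

⨁-nonempty : (h : Subset n → Bool) → ⨁ (λ T → does (nonempty? T) ∧ h T) ≡ ⨁ h xor h ⊥
⨁-nonempty h = begin
  ⨁ (λ T → does (nonempty? T) ∧ h T)   ≡⟨ ⨁-cong (λ T → cong (_∧ h T) (nonempty?-≡ᵇ T)) ⟩
  ⨁ (λ T → not (T ≡ᵇ ⊥) ∧ h T)         ≡⟨ ⨁-cong (λ T → not-∧ (T ≡ᵇ ⊥) (h T)) ⟩
  ⨁ (λ T → h T xor (T ≡ᵇ ⊥ ∧ h T))     ≡⟨ ⨁-xor h (λ T → T ≡ᵇ ⊥ ∧ h T) ⟩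
  ⨁ h xor ⨁ (λ T → T ≡ᵇ ⊥ ∧ h T)       ≡⟨ cong (⨁ h xor_) (⨁-point ⊥ h) ⟩
  ⨁ h xor h ⊥                           ∎
  where
  open ≡-Reasoning
  not-∧ : ∀ a b → not a ∧ b ≡ b xor (a ∧ b)
  not-∧ true  b = sym (xor-same b)
  not-∧ false b = sym (xor-identityʳ b)

-- The number of common subsets of U and x is 2^∣U ∩ x∣, odd exactly when U ∩ x = ∅.
⨁-common-subsets : (U x : Subset n) → ⨁ (λ T → T ⊆ᵇ U ∧ T ⊆ᵇ x) ≡ (U ∩ x) ≡ᵇ ⊥
⨁-common-subsets {zero} [] [] = refl
⨁-common-subsets {suc n} (false ∷ U) (_ ∷ x) =
  trans (cong (⨁ (λ T → T ⊆ᵇ U ∧ T ⊆ᵇ x) xor_) (⨁-false {n})) (trans (xor-identityʳ _) (⨁-common-subsets U x))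
⨁-common-subsets {suc n} (true ∷ U) (false ∷ x) =
  trans (cong₂ _xor_ (⨁-common-subsets U x) (trans (⨁-∧ʳ (_⊆ᵇ U) false) (∧-zeroʳ _))) (xor-identityʳ _)
⨁-common-subsets {suc n} (true ∷ U) (true ∷ x) = xor-same (⨁ (λ T → T ⊆ᵇ U ∧ T ⊆ᵇ x))

xorSum-++ : (xs ys : List Bool) → xorSum (xs ++ ys) ≡ xorSum xs xor xorSum ys
xorSum-++ []       ys = refl
xorSum-++ (x ∷ xs) ys = trans (cong (x xor_) (xorSum-++ xs ys)) (sym (xor-assoc x _ _))

xorSum-allSubsets : (h : Subset n → Bool) → xorSum (map h (allSubsets n)) ≡ ⨁ h
xorSum-allSubsets {zero}  h = xor-identityʳ (h [])
xorSum-allSubsets {suc n} h = begin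
  xorSum (map h (map (outside ∷_) (allSubsets n) ++ map (inside ∷_) (allSubsets n)))
    ≡⟨ cong xorSum (map-++ h (map (outside ∷_) (allSubsets n)) _) ⟩
  xorSum (map h (map (outside ∷_) (allSubsets n)) ++ map h (map (inside ∷_) (allSubsets n)))
    ≡⟨ xorSum-++ (map h (map (outside ∷_) (allSubsets n))) _ ⟩
  xorSum (map h (map (outside ∷_) (allSubsets n))) xor xorSum (map h (map (inside ∷_) (allSubsets n)))
    ≡⟨ sym (cong₂ (λ xs ys → xorSum xs xor xorSum ys) (map-∘ (allSubsets n)) (map-∘ (allSubsets n))) ⟩
  xorSum (map (λ V → h (outside ∷ V)) (allSubsets n)) xor xorSum (map (λ V → h (inside ∷ V)) (allSubsets n))
    ≡⟨ cong₂ _xor_ (xorSum-allSubsets (λ V → h (outside ∷ V))) (xorSum-allSubsets (λ V → h (inside ∷ V))) ⟩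
  ⨁ h ∎
  where open ≡-Reasoning

xorSum-filter : {A : Set} {P : Pred A 0ℓ} (P? : Decidable P) (g : A → Bool) (xs : List A) →
                xorSum (map g (filter P? xs)) ≡ xorSum (map (λ x → does (P? x) ∧ g x) xs)
xorSum-filter P? g []       = refl
xorSum-filter P? g (x ∷ xs) with does (P? x)
... | true  = cong (g x xor_) (xorSum-filter P? g xs)
... | false = xorSum-filter P? g xs

xorSum-concatMap : {A : Set} (f : A → List Bool) (xs : List A) →
                   xorSum (concatMap f xs) ≡ xorSum (map (λ x → xorSum (f x)) xs)
xorSum-concatMap f []       = refl
xorSum-concatMap f (x ∷ xs) =
  trans (xorSum-++ (f x) (concatMap f xs)) (cong (xorSum (f x) xor_) (xorSum-concatMap f xs))

*ₚ-coeff : (p q : BPoly n) (W : Subset n) →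
           (p *ₚ q) W ≡ ⨁ (λ A → ⨁ (λ C → (A ∪ C) ≡ᵇ W ∧ (p A ∧ q C)))
*ₚ-coeff {n} p q W = begin
  (p *ₚ q) W
    ≡⟨ xorSum-concatMap _ (allSubsets n) ⟩
  xorSum (map (λ A → xorSum (map (λ C → p A ∧ q C) (filter (λ C → (A ∪ C) ≟ₛ W) (allSubsets n))))
              (allSubsets n))
    ≡⟨ cong xorSum (map-cong (λ A → xorSum-filter (λ C → (A ∪ C) ≟ₛ W) _ (allSubsets n)) (allSubsets n)) ⟩
  xorSum (map (λ A → xorSum (map (λ C → (A ∪ C) ≡ᵇ W ∧ (p A ∧ q C)) (allSubsets n))) (allSubsets n))
    ≡⟨ cong xorSum (map-cong (λ A → xorSum-allSubsets {n} _) (allSubsets n)) ⟩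
  xorSum (map (λ A → ⨁ (λ C → (A ∪ C) ≡ᵇ W ∧ (p A ∧ q C))) (allSubsets n))
    ≡⟨ xorSum-allSubsets {n} _ ⟩
  ⨁ (λ A → ⨁ (λ C → (A ∪ C) ≡ᵇ W ∧ (p A ∧ q C))) ∎
  where open ≡-Reasoning

-- Evaluation

-- The value of p at the assignment that makes exactly the variables in x true.
eval : BPoly n → Subset n → Bool
eval p x = ⨁ (λ W → p W ∧ W ⊆ᵇ x)

eval-cong : {p q : BPoly n} → p ≈ q → ∀ x → eval p x ≡ eval q x
eval-cong p≈q x = ⨁-cong (λ W → cong (_∧ W ⊆ᵇ x) (p≈q W))

eval-𝟘 : (x : Subset n) → eval 𝟘 x ≡ false
eval-𝟘 {n} x = ⨁-false {n}

eval-+ : (p q : BPoly n) (x : Subset n) → eval (p +ₚ q) x ≡ eval p x xor eval q x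
eval-+ p q x = trans (⨁-cong (λ W → ∧-distribʳ-xor (W ⊆ᵇ x) (p W) (q W)))
                     (⨁-xor (λ W → p W ∧ W ⊆ᵇ x) (λ W → q W ∧ W ⊆ᵇ x))

eval-sumₚ : (ps : List (BPoly n)) (x : Subset n) →
            eval (sumₚ ps) x ≡ xorSum (map (λ p → eval p x) ps)
eval-sumₚ {n} []       x = ⨁-false {n}
eval-sumₚ     (p ∷ ps) x = trans (eval-+ p (sumₚ ps) x) (cong (eval p x xor_) (eval-sumₚ ps x))

eval-mon : (W x : Subset n) → eval (mon W) x ≡ W ⊆ᵇ x
eval-mon W x = trans (⨁-cong (λ V → cong (_∧ V ⊆ᵇ x) (isYes≗does (V ≟ₛ W)))) (⨁-point W (_⊆ᵇ x))

eval-* : (p q : BPoly n) (x : Subset n) → eval (p *ₚ q) x ≡ eval p x ∧ eval q x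
eval-* p q x = begin
  ⨁ (λ W → (p *ₚ q) W ∧ W ⊆ᵇ x)
    ≡⟨ ⨁-cong (λ W → cong (_∧ W ⊆ᵇ x) (*ₚ-coeff p q W)) ⟩
  ⨁ (λ W → ⨁ (λ A → ⨁ (λ C → term A C W)) ∧ W ⊆ᵇ x)
    ≡⟨ ⨁-cong (λ W → trans (sym (⨁-∧ʳ (λ A → ⨁ (λ C → term A C W)) (W ⊆ᵇ x)))
                           (⨁-cong (λ A → sym (⨁-∧ʳ (λ C → term A C W) (W ⊆ᵇ x))))) ⟩
  ⨁ (λ W → ⨁ (λ A → ⨁ (λ C → term A C W ∧ W ⊆ᵇ x)))
    ≡⟨ trans (⨁-comm (λ W A → ⨁ (λ C → term A C W ∧ W ⊆ᵇ x)))
             (⨁-cong (λ A → ⨁-comm (λ W C → term A C W ∧ W ⊆ᵇ x))) ⟩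
  ⨁ (λ A → ⨁ (λ C → ⨁ (λ W → term A C W ∧ W ⊆ᵇ x)))
    ≡⟨ ⨁-cong (λ A → ⨁-cong (λ C → collapse A C)) ⟩
  ⨁ (λ A → ⨁ (λ C → (p A ∧ A ⊆ᵇ x) ∧ (q C ∧ C ⊆ᵇ x)))
    ≡⟨ trans (⨁-cong (λ A → ⨁-∧ˡ (p A ∧ A ⊆ᵇ x) (λ C → q C ∧ C ⊆ᵇ x)))
             (⨁-∧ʳ (λ A → p A ∧ A ⊆ᵇ x) (eval q x)) ⟩
  eval p x ∧ eval q x ∎
  where
  open ≡-Reasoning
  term : Subset _ → Subset _ → Subset _ → Bool
  term A C W = (A ∪ C) ≡ᵇ W ∧ (p A ∧ q C)
  collapse : ∀ A C → ⨁ (λ W → term A C W ∧ W ⊆ᵇ x) ≡ (p A ∧ A ⊆ᵇ x) ∧ (q C ∧ C ⊆ᵇ x)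
  collapse A C = begin
    ⨁ (λ W → term A C W ∧ W ⊆ᵇ x)
      ≡⟨ ⨁-cong (λ W → trans (∧-assoc ((A ∪ C) ≡ᵇ W) (p A ∧ q C) (W ⊆ᵇ x))
                             (cong (_∧ ((p A ∧ q C) ∧ W ⊆ᵇ x)) (≡ᵇ-sym (A ∪ C) W))) ⟩
    ⨁ (λ W → W ≡ᵇ (A ∪ C) ∧ ((p A ∧ q C) ∧ W ⊆ᵇ x))
      ≡⟨ ⨁-point (A ∪ C) (λ W → (p A ∧ q C) ∧ W ⊆ᵇ x) ⟩
    (p A ∧ q C) ∧ (A ∪ C) ⊆ᵇ x
      ≡⟨ cong ((p A ∧ q C) ∧_) (∪-⊆ᵇ A C x) ⟩
    (p A ∧ q C) ∧ (A ⊆ᵇ x ∧ C ⊆ᵇ x)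
      ≡⟨ ∧-interchange (p A) (q C) (A ⊆ᵇ x) (C ⊆ᵇ x) ⟩
    (p A ∧ A ⊆ᵇ x) ∧ (q C ∧ C ⊆ᵇ x) ∎

-- Möbius inversion over the subset lattice.
eval-inversion : (p : BPoly n) (W : Subset n) → ⨁ (λ x → x ⊆ᵇ W ∧ eval p x) ≡ p W
eval-inversion p W = begin
  ⨁ (λ x → x ⊆ᵇ W ∧ ⨁ (λ V → p V ∧ V ⊆ᵇ x))
    ≡⟨ ⨁-cong (λ x → sym (⨁-∧ˡ (x ⊆ᵇ W) (λ V → p V ∧ V ⊆ᵇ x))) ⟩
  ⨁ (λ x → ⨁ (λ V → x ⊆ᵇ W ∧ (p V ∧ V ⊆ᵇ x)))
    ≡⟨ ⨁-comm (λ x V → x ⊆ᵇ W ∧ (p V ∧ V ⊆ᵇ x)) ⟩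
  ⨁ (λ V → ⨁ (λ x → x ⊆ᵇ W ∧ (p V ∧ V ⊆ᵇ x)))
    ≡⟨ ⨁-cong (λ V → trans (⨁-cong (λ x → rotate (x ⊆ᵇ W) (p V) (V ⊆ᵇ x)))
                           (⨁-∧ˡ (p V) (λ x → V ⊆ᵇ x ∧ x ⊆ᵇ W))) ⟩
  ⨁ (λ V → p V ∧ ⨁ (λ x → V ⊆ᵇ x ∧ x ⊆ᵇ W))
    ≡⟨ ⨁-cong (λ V → trans (cong (p V ∧_) (⨁-interval V W)) (∧-comm (p V) (V ≡ᵇ W))) ⟩
  ⨁ (λ V → V ≡ᵇ W ∧ p V)
    ≡⟨ ⨁-point W p ⟩
  p W ∎
  where
  open ≡-Reasoning
  rotate : ∀ a b c → a ∧ (b ∧ c) ≡ b ∧ (c ∧ a)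
  rotate a b c = trans (∧-comm a (b ∧ c)) (∧-assoc b c a)

eval-injective : {p q : BPoly n} → (∀ x → eval p x ≡ eval q x) → p ≈ q
eval-injective {p = p} {q} p≗q W = begin
  p W                                 ≡⟨ eval-inversion p W ⟨
  ⨁ (λ x → x ⊆ᵇ W ∧ eval p x)         ≡⟨ ⨁-cong (λ x → cong (x ⊆ᵇ W ∧_) (p≗q x)) ⟩
  ⨁ (λ x → x ⊆ᵇ W ∧ eval q x)         ≡⟨ eval-inversion q W ⟩
  q W                                 ∎
  where open ≡-Reasoning

eval-𝟙 : (x : Subset n) → eval 𝟙 x ≡ true
eval-𝟙 x = trans (eval-mon ⊥ x) (⊥-⊆ᵇ x)

eval-var : (i : Fin n) (x : Subset n) → eval (var i) x ≡ lookup x i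
eval-var i x = trans (eval-mon ⁅ i ⁆ x) (⁅⁆-⊆ᵇ i x)

eval-𝟙+var : (i : Fin n) (x : Subset n) → eval (𝟙 +ₚ var i) x ≡ not (lookup x i)
eval-𝟙+var i x = trans (eval-+ 𝟙 (var i) x) (cong₂ _xor_ (eval-𝟙 x) (eval-var i x))

allIn : Subset n → (Fin n → Bool) → Bool
allIn []      g = true
allIn (b ∷ X) g = if b then g zero ∧ allIn X (g ∘ suc) else allIn X (g ∘ suc)

allIn-cong : (X : Subset n) {g h : Fin n → Bool} → (∀ i → g i ≡ h i) → allIn X g ≡ allIn X h
allIn-cong []      g≗h = refl
allIn-cong (b ∷ X) g≗h = cong₂ (λ y acc → if b then y ∧ acc else acc) (g≗h zero) (allIn-cong X (g≗h ∘ suc))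

allIn-allFin : (X : Subset n) (g : Fin n → Bool) →
  V.foldr (λ _ → Bool) (λ i acc → if lookup X i then g i ∧ acc else acc) true (allFin n) ≡ allIn X g
allIn-allFin []      g = refl
allIn-allFin (b ∷ X) g =
  cong (λ acc → if b then g zero ∧ acc else acc) (trans (shift id) (allIn-allFin X (g ∘ suc)))
  where
  shift : ∀ {m} (h : Fin m → Fin _) →
    V.foldr (λ _ → Bool) (λ i acc → if lookup (b ∷ X) i then g i ∧ acc else acc) true (tabulate (suc ∘ h))
    ≡ V.foldr (λ _ → Bool) (λ i acc → if lookup X i then g (suc i) ∧ acc else acc) true (tabulate h)
  shift {zero}  h = refl
  shift {suc m} h = cong (λ acc → if lookup X (h zero) then g (suc (h zero)) ∧ acc else acc) (shift (h ∘ suc))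

eval-prodOver : (X : Subset n) (f : Fin n → BPoly n) (x : Subset n) →
                eval (prodOver X f) x ≡ allIn X (λ i → eval (f i) x)
eval-prodOver {n} X f x = trans (evalFold (allFin n)) (allIn-allFin X (λ i → eval (f i) x))
  where
  evalFold : ∀ {m} (is : Vec (Fin n) m) →
    eval (V.foldr (λ _ → BPoly n) (λ i acc → if lookup X i then f i *ₚ acc else acc) 𝟙 is) x
    ≡ V.foldr (λ _ → Bool) (λ i acc → if lookup X i then eval (f i) x ∧ acc else acc) true is
  evalFold []       = eval-𝟙 x
  evalFold (i ∷ is) with lookup X i
  ... | true  = trans (eval-* (f i) _ x) (cong (eval (f i) x ∧_) (evalFold is))
  ... | false = evalFold is

allIn-lookup : (X x : Subset n) → allIn X (lookup x) ≡ X ⊆ᵇ x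
allIn-lookup []          []          = refl
allIn-lookup (false ∷ X) (_     ∷ x) = allIn-lookup X x
allIn-lookup (true  ∷ X) (false ∷ x) = refl
allIn-lookup (true  ∷ X) (true  ∷ x) = allIn-lookup X x

allIn-not-lookup : (X x : Subset n) → allIn X (not ∘ lookup x) ≡ (X ∩ x) ≡ᵇ ⊥
allIn-not-lookup []          []          = refl
allIn-not-lookup (false ∷ X) (_     ∷ x) = allIn-not-lookup X x
allIn-not-lookup (true  ∷ X) (false ∷ x) = allIn-not-lookup X x
allIn-not-lookup (true  ∷ X) (true  ∷ x) = refl

-- The truth table of the clause

eval-clauseANF : (P N x : Subset n) → eval (clauseANF P N) x ≡ not ((P ∩ x) ≡ᵇ ⊥ ∧ N ⊆ᵇ x)
eval-clauseANF P N x = begin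
  eval (clauseANF P N) x
    ≡⟨ eval-+ 𝟙 _ x ⟩
  eval 𝟙 x xor eval (prodOver P (λ i → 𝟙 +ₚ var i) *ₚ prodOver N var) x
    ≡⟨ cong₂ _xor_ (eval-𝟙 x) (eval-* _ _ x) ⟩
  not (eval (prodOver P (λ i → 𝟙 +ₚ var i)) x ∧ eval (prodOver N var) x)
    ≡⟨ cong not (cong₂ _∧_ (trans (eval-prodOver P _ x) (allIn-cong P (λ i → eval-𝟙+var i x)))
                           (trans (eval-prodOver N var x) (allIn-cong N (λ i → eval-var i x)))) ⟩
  not (allIn P (not ∘ lookup x) ∧ allIn N (lookup x))
    ≡⟨ cong not (cong₂ _∧_ (allIn-not-lookup P x) (allIn-lookup N x)) ⟩
  not ((P ∩ x) ≡ᵇ ⊥ ∧ N ⊆ᵇ x) ∎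
  where open ≡-Reasoning

eval-clauseANF-positive : (P N : Subset n) → N ≡ ⊥ → (x : Subset n) →
                          eval (clauseANF P N) x ≡ not ((P ∩ x) ≡ᵇ ⊥)
eval-clauseANF-positive P N refl x = begin
  eval (clauseANF P ⊥) x          ≡⟨ eval-clauseANF P ⊥ x ⟩
  not ((P ∩ x) ≡ᵇ ⊥ ∧ ⊥ ⊆ᵇ x)     ≡⟨ cong (λ d → not ((P ∩ x) ≡ᵇ ⊥ ∧ d)) (⊥-⊆ᵇ x) ⟩
  not ((P ∩ x) ≡ᵇ ⊥ ∧ true)       ≡⟨ cong not (∧-identityʳ ((P ∩ x) ≡ᵇ ⊥)) ⟩
  not ((P ∩ x) ≡ᵇ ⊥)              ∎
  where open ≡-Reasoning

eval-clauseANF-negative : (P N : Subset n) → P ≡ ⊥ → (x : Subset n) →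
                          eval (clauseANF P N) x ≡ not (N ⊆ᵇ x)
eval-clauseANF-negative P N refl x =
  trans (eval-clauseANF ⊥ N x) (cong (λ c → not (c ∧ N ⊆ᵇ x)) (dec-true ((⊥ ∩ x) ≟ₛ ⊥) (∩-zeroˡ x)))

clauseANF-at-⊥ : (P N : Subset n) → N ≢ ⊥ → eval (clauseANF P N) ⊥ ≡ true
clauseANF-at-⊥ P N N≢⊥ = trans (eval-clauseANF P N ⊥)
  (cong₂ (λ c d → not (c ∧ d)) (dec-true ((P ∩ ⊥) ≟ₛ ⊥) (∩-zeroʳ P))
                               (dec-false (N ⊆? ⊥) (λ N⊆⊥ → N≢⊥ (⊆-antisym N⊆⊥ ⊥⊆))))

clauseANF-at-⊤ : (P N : Subset n) → eval (clauseANF P N) ⊤ ≡ not (P ≡ᵇ ⊥)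
clauseANF-at-⊤ P N = trans (eval-clauseANF P N ⊤)
  (trans (cong₂ (λ V d → not (V ≡ᵇ ⊥ ∧ d)) (∩-identityʳ P) (dec-true (N ⊆? ⊤) ⊆⊤))
         (cong not (∧-identityʳ (P ≡ᵇ ⊥))))

clauseANF-at-N : (P N : Subset n) → P ∩ N ≡ ⊥ → eval (clauseANF P N) N ≡ false
clauseANF-at-N P N P∩N≡⊥ = trans (eval-clauseANF P N N)
  (cong₂ (λ c d → not (c ∧ d)) (dec-true ((P ∩ N) ≟ₛ ⊥) P∩N≡⊥) (dec-true (N ⊆? N) ⊆-refl))

-- The truth table of a power term

eval-pt-sum : (S U x : Subset n) → eval ⟦ pt S U ⟧ₐ x ≡ xorSum (map (λ T → (S ∪ T) ⊆ᵇ x) (powerSetP U))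
eval-pt-sum S U x = begin
  eval (sumₚ (map (λ T → mon (S ∪ T)) (powerSetP U))) x
    ≡⟨ eval-sumₚ (map (λ T → mon (S ∪ T)) (powerSetP U)) x ⟩
  xorSum (map (λ p → eval p x) (map (λ T → mon (S ∪ T)) (powerSetP U)))
    ≡⟨ cong xorSum (map-∘ (powerSetP U)) ⟨
  xorSum (map (λ T → eval (mon (S ∪ T)) x) (powerSetP U))
    ≡⟨ cong xorSum (map-cong (λ T → eval-mon (S ∪ T) x) (powerSetP U)) ⟩
  xorSum (map (λ T → (S ∪ T) ⊆ᵇ x) (powerSetP U)) ∎
  where open ≡-Reasoning

eval-pt-∅ : (S U x : Subset n) → ∣ U ∣ ≡ 0 → eval ⟦ pt S U ⟧ₐ x ≡ S ⊆ᵇ x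
eval-pt-∅ S U x ∣U∣≡0 rewrite eval-pt-sum S U x | ∣U∣≡0 | ∪-identityʳ S = xor-identityʳ (S ⊆ᵇ x)

eval-pt : (S U x : Subset n) {k : ℕ} → ∣ U ∣ ≡ suc k → eval ⟦ pt S U ⟧ₐ x ≡ S ⊆ᵇ x ∧ not ((U ∩ x) ≡ᵇ ⊥)
eval-pt {n} S U x ∣U∣≡1+k rewrite eval-pt-sum S U x | ∣U∣≡1+k = begin
  xorSum (map g (filter (_⊆? U) (filter nonempty? (allSubsets n))))
    ≡⟨ xorSum-filter (_⊆? U) g (filter nonempty? (allSubsets n)) ⟩
  xorSum (map (λ T → T ⊆ᵇ U ∧ g T) (filter nonempty? (allSubsets n)))
    ≡⟨ xorSum-filter nonempty? (λ T → T ⊆ᵇ U ∧ g T) (allSubsets n) ⟩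
  xorSum (map (λ T → does (nonempty? T) ∧ (T ⊆ᵇ U ∧ g T)) (allSubsets n))
    ≡⟨ xorSum-allSubsets (λ T → does (nonempty? T) ∧ (T ⊆ᵇ U ∧ g T)) ⟩
  ⨁ (λ T → does (nonempty? T) ∧ (T ⊆ᵇ U ∧ g T))
    ≡⟨ ⨁-nonempty (λ T → T ⊆ᵇ U ∧ g T) ⟩
  ⨁ (λ T → T ⊆ᵇ U ∧ g T) xor (⊥ ⊆ᵇ U ∧ g ⊥)
    ≡⟨ cong₂ _xor_ (⨁-cong (λ T → cong (T ⊆ᵇ U ∧_) (∪-⊆ᵇ S T x)))
                   (cong₂ _∧_ (⊥-⊆ᵇ U) (cong (_⊆ᵇ x) (∪-identityʳ S))) ⟩
  ⨁ (λ T → T ⊆ᵇ U ∧ (S ⊆ᵇ x ∧ T ⊆ᵇ x)) xor S ⊆ᵇ x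
    ≡⟨ cong (_xor S ⊆ᵇ x) (trans (⨁-cong (λ T → ∧-middle (T ⊆ᵇ U) (S ⊆ᵇ x) (T ⊆ᵇ x)))
                                  (⨁-∧ˡ (S ⊆ᵇ x) (λ T → T ⊆ᵇ U ∧ T ⊆ᵇ x))) ⟩
  (S ⊆ᵇ x ∧ ⨁ (λ T → T ⊆ᵇ U ∧ T ⊆ᵇ x)) xor S ⊆ᵇ x
    ≡⟨ cong (λ c → (S ⊆ᵇ x ∧ c) xor S ⊆ᵇ x) (⨁-common-subsets U x) ⟩
  (S ⊆ᵇ x ∧ (U ∩ x) ≡ᵇ ⊥) xor S ⊆ᵇ x
    ≡⟨ ∧-xor-self (S ⊆ᵇ x) ((U ∩ x) ≡ᵇ ⊥) ⟩
  S ⊆ᵇ x ∧ not ((U ∩ x) ≡ᵇ ⊥) ∎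
  where
  open ≡-Reasoning
  g : Subset n → Bool
  g T = (S ∪ T) ⊆ᵇ x
  ∧-middle : ∀ a b c → a ∧ (b ∧ c) ≡ b ∧ (a ∧ c)
  ∧-middle a b c = trans (sym (∧-assoc a b c)) (trans (cong (_∧ c) (∧-comm a b)) (∧-assoc b a c))
  ∧-xor-self : ∀ a c → (a ∧ c) xor a ≡ a ∧ not c
  ∧-xor-self false c = refl
  ∧-xor-self true  c = xor-comm c true

eval-pt-at-⊥ : (S U : Subset n) → ¬ (S ≡ ⊥ × U ≡ ⊥) → eval ⟦ pt S U ⟧ₐ ⊥ ≡ false
eval-pt-at-⊥ S U S,U≢⊥ = byCardinality ∣ U ∣ refl
  where
  open ≡-Reasoning
  byCardinality : ∀ k → ∣ U ∣ ≡ k → eval ⟦ pt S U ⟧ₐ ⊥ ≡ false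
  byCardinality zero    ∣U∣≡0 = trans (eval-pt-∅ S U ⊥ ∣U∣≡0)
    (dec-false (S ⊆? ⊥) (λ S⊆⊥ → S,U≢⊥ (⊆-antisym S⊆⊥ ⊥⊆ , ∣∣≡0⇒≡⊥ U ∣U∣≡0)))
  byCardinality (suc k) ∣U∣≡1+k = begin
    eval ⟦ pt S U ⟧ₐ ⊥               ≡⟨ eval-pt S U ⊥ ∣U∣≡1+k ⟩
    S ⊆ᵇ ⊥ ∧ not ((U ∩ ⊥) ≡ᵇ ⊥)      ≡⟨ cong (λ b → S ⊆ᵇ ⊥ ∧ not b) (dec-true ((U ∩ ⊥) ≟ₛ ⊥) (∩-zeroʳ U)) ⟩
    S ⊆ᵇ ⊥ ∧ false                    ≡⟨ ∧-zeroʳ (S ⊆ᵇ ⊥) ⟩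
    false                             ∎

eval-pt-at-⊤ : (S U : Subset n) → eval ⟦ pt S U ⟧ₐ ⊤ ≡ true
eval-pt-at-⊤ S U = byCardinality ∣ U ∣ refl
  where
  open ≡-Reasoning
  byCardinality : ∀ k → ∣ U ∣ ≡ k → eval ⟦ pt S U ⟧ₐ ⊤ ≡ true
  byCardinality zero    ∣U∣≡0   = trans (eval-pt-∅ S U ⊤ ∣U∣≡0) (dec-true (S ⊆? ⊤) ⊆⊤)
  byCardinality (suc k) ∣U∣≡1+k = begin
    eval ⟦ pt S U ⟧ₐ ⊤               ≡⟨ eval-pt S U ⊤ ∣U∣≡1+k ⟩
    S ⊆ᵇ ⊤ ∧ not ((U ∩ ⊤) ≡ᵇ ⊥)      ≡⟨ cong₂ (λ b V → b ∧ not (V ≡ᵇ ⊥)) (dec-true (S ⊆? ⊤) ⊆⊤) (∩-identityʳ U) ⟩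
    not (U ≡ᵇ ⊥)                      ≡⟨ cong not (dec-false (U ≟ₛ ⊥) (∣∣≡suc⇒≢⊥ U ∣U∣≡1+k)) ⟩
    true                              ∎

data Shape (f : Subset n → Bool) : Set where
  constant : (c : Bool) → (∀ x → f x ≡ c) → Shape f
  rising   : f ⊥ ≡ false → f ⊤ ≡ true → Shape f

shape : (a : Atom n) → WellFormed a → Shape (eval ⟦ a ⟧ₐ)
shape constZero _                 = constant false eval-𝟘
shape constOne  _                 = constant true eval-𝟙
shape (pt S U)  (_ , _ , S,U≢⊥)   = rising (eval-pt-at-⊥ S U S,U≢⊥) (eval-pt-at-⊤ S U)

shape-true-at-⊥ : {f : Subset n → Bool} → Shape f → f ⊥ ≡ true → ∀ x → f x ≡ true
shape-true-at-⊥ (constant c f≗c) f⊥ x = trans (f≗c x) (trans (sym (f≗c ⊥)) f⊥)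
shape-true-at-⊥ (rising f⊥≡false _) f⊥ x = contradiction (trans (sym f⊥≡false) f⊥) λ ()

shapes-true-at-⊥-⊤ : {f g : Subset n → Bool} → Shape f → Shape g →
  f ⊥ xor g ⊥ ≡ true → f ⊤ xor g ⊤ ≡ true → ∀ x → f x xor g x ≡ true
shapes-true-at-⊥-⊤ (constant c f≗c) (constant d g≗d) h⊥ _ x =
  trans (cong₂ _xor_ (f≗c x) (g≗d x)) (trans (sym (cong₂ _xor_ (f≗c ⊥) (g≗d ⊥))) h⊥)
shapes-true-at-⊥-⊤ (constant false f≗false) (rising g⊥ _) h⊥ _ _ =
  contradiction (trans (sym (cong₂ _xor_ (f≗false ⊥) g⊥)) h⊥) λ ()
shapes-true-at-⊥-⊤ (constant true f≗true) (rising _ g⊤) _ h⊤ _ =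
  contradiction (trans (sym (cong₂ _xor_ (f≗true ⊤) g⊤)) h⊤) λ ()
shapes-true-at-⊥-⊤ (rising f⊥ _) (constant false g≗false) h⊥ _ _ =
  contradiction (trans (sym (cong₂ _xor_ f⊥ (g≗false ⊥))) h⊥) λ ()
shapes-true-at-⊥-⊤ (rising _ f⊤) (constant true g≗true) _ h⊤ _ =
  contradiction (trans (sym (cong₂ _xor_ f⊤ (g≗true ⊤))) h⊤) λ ()
shapes-true-at-⊥-⊤ (rising f⊥ _) (rising g⊥ _) h⊥ _ _ =
  contradiction (trans (sym (cong₂ _xor_ f⊥ g⊥)) h⊥) λ ()

-- Lower bounds on the size of a representation

eval-⟦⟧ : (π : PTPoly n) (x : Subset n) → eval ⟦ π ⟧ x ≡ xorSum (map (λ a → eval ⟦ a ⟧ₐ x) π)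
eval-⟦⟧ π x = trans (eval-sumₚ (map ⟦_⟧ₐ π) x) (cong xorSum (sym (map-∘ π)))

eval-single : (a : Atom n) {p : BPoly n} → ⟦ a ∷ [] ⟧ ≈ p → ∀ x → eval ⟦ a ⟧ₐ x ≡ eval p x
eval-single a ρ≈p x = trans (sym (xor-identityʳ _)) (trans (sym (eval-⟦⟧ (a ∷ []) x)) (eval-cong ρ≈p x))

eval-pair : (a b : Atom n) {p : BPoly n} → ⟦ a ∷ b ∷ [] ⟧ ≈ p →
         ∀ x → eval ⟦ a ⟧ₐ x xor eval ⟦ b ⟧ₐ x ≡ eval p x
eval-pair a b ρ≈p x = trans (cong (eval ⟦ a ⟧ₐ x xor_) (sym (xor-identityʳ _)))
                         (trans (sym (eval-⟦⟧ (a ∷ b ∷ []) x)) (eval-cong ρ≈p x))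

size≥1 : (ρ : PTPoly n) {p : BPoly n} → ⟦ ρ ⟧ ≈ p → (x : Subset n) → eval p x ≡ true → 1 ≤ Size ρ
size≥1 []      ρ≈p x px = contradiction (trans (sym (eval-𝟘 x)) (trans (eval-cong ρ≈p x) px)) λ ()
size≥1 (_ ∷ _) _   _ _  = s≤s z≤n

size≥2 : (ρ : PTPoly n) {p : BPoly n} → WellFormedPTP ρ → ⟦ ρ ⟧ ≈ p →
         eval p ⊥ ≡ true → eval p ⊤ ≡ false → 2 ≤ Size ρ
size≥2 []              _         ρ≈p p⊥ _  = contradiction (size≥1 [] ρ≈p ⊥ p⊥) λ ()
size≥2 (a ∷ []) {p}    (wa ∷ []) ρ≈p p⊥ p⊤ = ⊥-elim (not-¬ p⊤-true p⊤)
  where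
  p⊤-true : eval p ⊤ ≡ true
  p⊤-true = trans (sym (eval-single a ρ≈p ⊤)) (shape-true-at-⊥ (shape a wa) (trans (eval-single a ρ≈p ⊥) p⊥) ⊤)
size≥2 (_ ∷ _ ∷ _)     _         _   _  _  = s≤s (s≤s z≤n)

size≥3 : (ρ : PTPoly n) {p : BPoly n} → WellFormedPTP ρ → ⟦ ρ ⟧ ≈ p →
         eval p ⊥ ≡ true → eval p ⊤ ≡ true → (x : Subset n) → eval p x ≡ false → 3 ≤ Size ρ
size≥3 []                  _              ρ≈p p⊥ _  _ _  = contradiction (size≥1 [] ρ≈p ⊥ p⊥) λ ()
size≥3 (a ∷ []) {p}        (wa ∷ [])      ρ≈p p⊥ _  x px = ⊥-elim (not-¬ px-true px)
  where
  px-true : eval p x ≡ true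
  px-true = trans (sym (eval-single a ρ≈p x)) (shape-true-at-⊥ (shape a wa) (trans (eval-single a ρ≈p ⊥) p⊥) x)
size≥3 (a ∷ b ∷ []) {p}    (wa ∷ wb ∷ []) ρ≈p p⊥ p⊤ x px = ⊥-elim (not-¬ px-true px)
  where
  px-true : eval p x ≡ true
  px-true = trans (sym (eval-pair a b ρ≈p x))
    (shapes-true-at-⊥-⊤ (shape a wa) (shape b wb) (trans (eval-pair a b ρ≈p ⊥) p⊥) (trans (eval-pair a b ρ≈p ⊤) p⊤) x)
size≥3 (_ ∷ _ ∷ _ ∷ _)     _              _   _  _  _ _  = s≤s (s≤s (s≤s z≤n))

clauseANF-size≥1 : {P N : Subset n} → P ≢ ⊥ →
  ∀ ρ → WellFormedPTP ρ → ⟦ ρ ⟧ ≈ clauseANF P N → 1 ≤ Size ρ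
clauseANF-size≥1 {P = P} {N} P≢⊥ ρ _ ρ≈φ =
  size≥1 ρ ρ≈φ ⊤ (trans (clauseANF-at-⊤ P N) (cong not (dec-false (P ≟ₛ ⊥) P≢⊥)))

clauseANF-size≥2 : {P N : Subset n} → P ≡ ⊥ → N ≢ ⊥ →
  ∀ ρ → WellFormedPTP ρ → ⟦ ρ ⟧ ≈ clauseANF P N → 2 ≤ Size ρ
clauseANF-size≥2 {P = P} {N} P≡⊥ N≢⊥ ρ wf ρ≈φ = size≥2 ρ wf ρ≈φ
  (clauseANF-at-⊥ P N N≢⊥) (trans (clauseANF-at-⊤ P N) (cong not (dec-true (P ≟ₛ ⊥) P≡⊥)))

clauseANF-size≥3 : {P N : Subset n} → P ∩ N ≡ ⊥ → P ≢ ⊥ → N ≢ ⊥ →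
  ∀ ρ → WellFormedPTP ρ → ⟦ ρ ⟧ ≈ clauseANF P N → 3 ≤ Size ρ
clauseANF-size≥3 {P = P} {N} P∩N≡⊥ P≢⊥ N≢⊥ ρ wf ρ≈φ = size≥3 ρ wf ρ≈φ
  (clauseANF-at-⊥ P N N≢⊥) (trans (clauseANF-at-⊤ P N) (cong not (dec-false (P ≟ₛ ⊥) P≢⊥)))
  N (clauseANF-at-N P N P∩N≡⊥)

wf-monomial : {S : Subset n} → S ≢ ⊥ → WellFormed (pt S ⊥)
wf-monomial {n} {S} S≢⊥ = ∩-zeroʳ S , (λ ∣⊥∣≡1 → contradiction (trans (sym (∣⊥∣≡0 n)) ∣⊥∣≡1) λ ()) , S≢⊥ ∘ proj₁

wf-power : {S U : Subset n} {k : ℕ} → S ∩ U ≡ ⊥ → ∣ U ∣ ≡ suc (suc k) → WellFormed (pt S U)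
wf-power {U = U} S∩U≡⊥ ∣U∣≡2+k =
  S∩U≡⊥ , (λ ∣U∣≡1 → contradiction (trans (sym ∣U∣≡2+k) ∣U∣≡1) λ ()) , ∣∣≡suc⇒≢⊥ U ∣U∣≡2+k ∘ proj₂

SizeClaims : Subset n → Subset n → ℕ → Set
SizeClaims P N s = s ≤ 3 × (N ≡ ⊥ → s ≡ 1) × (P ≡ ⊥ → s ≡ 2) × (P ≢ ⊥ → N ≢ ⊥ → s ≡ 3)

Conclusion : Subset n → Subset n → PTPoly n → Set
Conclusion P N π = WellFormedPTP π × Minimal π (clauseANF P N) × SizeClaims P N (Size π)

sizeClaims₁ : {P N : Subset n} → P ≢ ⊥ → N ≡ ⊥ → SizeClaims P N 1
sizeClaims₁ P≢⊥ N≡⊥ = s≤s z≤n , (λ _ → refl) , (λ P≡⊥ → contradiction P≡⊥ P≢⊥) , (λ _ N≢⊥ → contradiction N≡⊥ N≢⊥)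

sizeClaims₂ : {P N : Subset n} → P ≡ ⊥ → N ≢ ⊥ → SizeClaims P N 2
sizeClaims₂ P≡⊥ N≢⊥ = s≤s (s≤s z≤n) , (λ N≡⊥ → contradiction N≡⊥ N≢⊥) , (λ _ → refl) , (λ P≢⊥ _ → contradiction P≡⊥ P≢⊥)

sizeClaims₃ : {P N : Subset n} → P ≢ ⊥ → N ≢ ⊥ → SizeClaims P N 3
sizeClaims₃ P≢⊥ N≢⊥ = s≤s (s≤s (s≤s z≤n)) , (λ N≡⊥ → contradiction N≡⊥ N≢⊥) , (λ P≡⊥ → contradiction P≡⊥ P≢⊥) , (λ _ _ → refl)

positive-semantics : (P N : Subset n) → N ≡ ⊥ → (a : Atom n) →
  (∀ x → eval ⟦ a ⟧ₐ x ≡ not ((P ∩ x) ≡ᵇ ⊥)) → ⟦ a ∷ [] ⟧ ≈ clauseANF P N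
positive-semantics P N N≡⊥ a a≗ = eval-injective λ x →
  trans (eval-⟦⟧ (a ∷ []) x)
        (trans (xor-identityʳ _) (trans (a≗ x) (sym (eval-clauseANF-positive P N N≡⊥ x))))

negative-semantics : (P N : Subset n) → P ≡ ⊥ → ⟦ constOne ∷ pt N ⊥ ∷ [] ⟧ ≈ clauseANF P N
negative-semantics {n} P N P≡⊥ = eval-injective λ x → begin
  eval ⟦ constOne ∷ pt N ⊥ ∷ [] ⟧ x                  ≡⟨ eval-⟦⟧ (constOne ∷ pt N ⊥ ∷ []) x ⟩
  eval 𝟙 x xor (eval ⟦ pt N ⊥ ⟧ₐ x xor false)
    ≡⟨ cong₂ _xor_ (eval-𝟙 x) (trans (xor-identityʳ _) (eval-pt-∅ N ⊥ x (∣⊥∣≡0 n))) ⟩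
  not (N ⊆ᵇ x)                                       ≡⟨ eval-clauseANF-negative P N P≡⊥ x ⟨
  eval (clauseANF P N) x                             ∎
  where open ≡-Reasoning

mixed-semantics : (P N : Subset n) (a : Atom n) →
  (∀ x → eval ⟦ a ⟧ₐ x ≡ N ⊆ᵇ x ∧ not ((P ∩ x) ≡ᵇ ⊥)) →
  ⟦ constOne ∷ pt N ⊥ ∷ a ∷ [] ⟧ ≈ clauseANF P N
mixed-semantics {n} P N a a≗ = eval-injective λ x → begin
  eval ⟦ constOne ∷ pt N ⊥ ∷ a ∷ [] ⟧ x
    ≡⟨ eval-⟦⟧ (constOne ∷ pt N ⊥ ∷ a ∷ []) x ⟩
  eval 𝟙 x xor (eval ⟦ pt N ⊥ ⟧ₐ x xor (eval ⟦ a ⟧ₐ x xor false))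
    ≡⟨ cong₂ _xor_ (eval-𝟙 x) (cong₂ _xor_ (eval-pt-∅ N ⊥ x (∣⊥∣≡0 n)) (cong (_xor false) (a≗ x))) ⟩
  not (N ⊆ᵇ x xor ((N ⊆ᵇ x ∧ not ((P ∩ x) ≡ᵇ ⊥)) xor false))
    ≡⟨ table (N ⊆ᵇ x) ((P ∩ x) ≡ᵇ ⊥) ⟩
  not ((P ∩ x) ≡ᵇ ⊥ ∧ N ⊆ᵇ x)
    ≡⟨ eval-clauseANF P N x ⟨
  eval (clauseANF P N) x ∎
  where
  open ≡-Reasoning
  table : ∀ d c → not (d xor ((d ∧ not c) xor false)) ≡ not (c ∧ d)
  table false false = refl
  table false true  = refl
  table true  false = refl
  table true  true  = refl

positive-singleton : (P N : Subset n) → ∣ P ∣ ≡ 1 → N ≡ ⊥ → Conclusion P N (pt P ⊥ ∷ [])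
positive-singleton {n} P N ∣P∣≡1 N≡⊥ =
  wf-monomial P≢⊥ ∷ [] ,
  (positive-semantics P N N≡⊥ (pt P ⊥) (λ x → trans (eval-pt-∅ P ⊥ x (∣⊥∣≡0 n)) (⊆ᵇ-singleton P x ∣P∣≡1)) ,
   clauseANF-size≥1 {N = N} P≢⊥) ,
  sizeClaims₁ P≢⊥ N≡⊥
  where P≢⊥ = ∣∣≡suc⇒≢⊥ P ∣P∣≡1

positive : (P N : Subset n) {k : ℕ} → ∣ P ∣ ≡ suc (suc k) → N ≡ ⊥ → Conclusion P N (pt ⊥ P ∷ [])
positive P N ∣P∣≡2+k N≡⊥ =
  wf-power (∩-zeroˡ P) ∣P∣≡2+k ∷ [] ,
  (positive-semantics P N N≡⊥ (pt ⊥ P) (λ x → trans (eval-pt ⊥ P x ∣P∣≡2+k) (cong (_∧ not ((P ∩ x) ≡ᵇ ⊥)) (⊥-⊆ᵇ x))) ,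
   clauseANF-size≥1 {N = N} P≢⊥) ,
  sizeClaims₁ P≢⊥ N≡⊥
  where P≢⊥ = ∣∣≡suc⇒≢⊥ P ∣P∣≡2+k

negative : (P N : Subset n) → P ≡ ⊥ → N ≢ ⊥ → Conclusion P N (constOne ∷ pt N ⊥ ∷ [])
negative P N P≡⊥ N≢⊥ =
  tt ∷ wf-monomial N≢⊥ ∷ [] ,
  (negative-semantics P N P≡⊥ , clauseANF-size≥2 P≡⊥ N≢⊥) ,
  sizeClaims₂ P≡⊥ N≢⊥

mixed-singleton : (P N : Subset n) → P ∩ N ≡ ⊥ → ∣ P ∣ ≡ 1 → N ≢ ⊥ →
             Conclusion P N (constOne ∷ pt N ⊥ ∷ pt (N ∪ P) ⊥ ∷ [])
mixed-singleton {n} P N P∩N≡⊥ ∣P∣≡1 N≢⊥ =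
  tt ∷ wf-monomial N≢⊥ ∷ wf-monomial N∪P≢⊥ ∷ [] ,
  (mixed-semantics P N (pt (N ∪ P) ⊥) (λ x →
     trans (eval-pt-∅ (N ∪ P) ⊥ x (∣⊥∣≡0 n)) (trans (∪-⊆ᵇ N P x) (cong (N ⊆ᵇ x ∧_) (⊆ᵇ-singleton P x ∣P∣≡1)))) ,
   clauseANF-size≥3 P∩N≡⊥ P≢⊥ N≢⊥) ,
  sizeClaims₃ P≢⊥ N≢⊥
  where
  P≢⊥ = ∣∣≡suc⇒≢⊥ P ∣P∣≡1
  N∪P≢⊥ : N ∪ P ≢ ⊥
  N∪P≢⊥ N∪P≡⊥ = N≢⊥ (⊆-antisym (subst (N ⊆_) N∪P≡⊥ (p⊆p∪q P)) ⊥⊆)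

mixed : (P N : Subset n) {k : ℕ} → P ∩ N ≡ ⊥ → ∣ P ∣ ≡ suc (suc k) → N ≢ ⊥ →
        Conclusion P N (constOne ∷ pt N ⊥ ∷ pt N P ∷ [])
mixed P N P∩N≡⊥ ∣P∣≡2+k N≢⊥ =
  tt ∷ wf-monomial N≢⊥ ∷ wf-power (trans (∩-comm N P) P∩N≡⊥) ∣P∣≡2+k ∷ [] ,
  (mixed-semantics P N (pt N P) (λ x → eval-pt N P x ∣P∣≡2+k) , clauseANF-size≥3 P∩N≡⊥ P≢⊥ N≢⊥) ,
  sizeClaims₃ P≢⊥ N≢⊥
  where P≢⊥ = ∣∣≡suc⇒≢⊥ P ∣P∣≡2+k

mainTheorem2 : (n : ℕ) (P N : Subset n) → P ∩ N ≡ ⊥ → ¬ ((P ≡ ⊥) × (N ≡ ⊥)) →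
    WellFormedPTP (clausePTP P N)
    × Minimal (clausePTP P N) (clauseANF P N)
    × Size (clausePTP P N) ≤ 3
    × (N ≡ ⊥ → Size (clausePTP P N) ≡ 1)
    × (P ≡ ⊥ → Size (clausePTP P N) ≡ 2)
    × (P ≢ ⊥ → N ≢ ⊥ → Size (clausePTP P N) ≡ 3)
mainTheorem2 n P N P∩N≡⊥ P,N≢⊥ with ∣ P ∣ in ∣P∣≡k | ∣ N ∣ in ∣N∣≡l
... | zero        | zero  = contradiction (∣∣≡0⇒≡⊥ P ∣P∣≡k , ∣∣≡0⇒≡⊥ N ∣N∣≡l) P,N≢⊥
... | suc zero    | zero  = positive-singleton P N ∣P∣≡k (∣∣≡0⇒≡⊥ N ∣N∣≡l)
... | suc (suc _) | zero  = positive P N ∣P∣≡k (∣∣≡0⇒≡⊥ N ∣N∣≡l)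
... | zero        | suc _ = negative P N (∣∣≡0⇒≡⊥ P ∣P∣≡k) (∣∣≡suc⇒≢⊥ N ∣N∣≡l)
... | suc zero    | suc _ = mixed-singleton P N P∩N≡⊥ ∣P∣≡k (∣∣≡suc⇒≢⊥ N ∣N∣≡l)
... | suc (suc _) | suc _ = mixed P N P∩N≡⊥ ∣P∣≡k (∣∣≡suc⇒≢⊥ N ∣N∣≡l)
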